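{- Let $C$ be the Conolly sequence: $C(1)=C(2)=1$ and $C(n)=C(n-C(n-1))+C(n-1-C(n-2))$ for $n\ge3$. Define $M_1(1)=M_1(2)=1$ and $M_1(n)=M_1(n-C(n-1))+1$ for $n\ge 3$. Then $M_1$ is slow-growing, and for every $g\ge2$, $\{n : M_1(n)=g\}=[2^{g-1}+1,\,2^g]$.
   Context: A sequence is slow-growing if it is nondecreasing with successive differences in $\{0,1\}$. $M_1$ is the maternal generation sequence of $C$, based on the spot function $S_1(n)=n-C(n-1)$. -}

module Defs where

open import Data.Nat using (ℕ; zero; suc; _+_; _∸_; _≤ᵇ_; _≤_)
open import Data.Bool using (if_then_else_)
open import Data.Sum using (_⊎_)
open import Relation.Binary.PropositionalEquality using (_≡_)

-- Course-of-values construction of the Conolly sequence.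
-- conollyUpTo k is a function agreeing with C on the indices 1..k
-- (index 0 is outside the domain of C; its value is an arbitrary filler 0).
conollyUpTo : ℕ → (ℕ → ℕ)
conollyUpTo zero = λ _ → 0
conollyUpTo (suc k) = λ i → if i ≤ᵇ k then prev i else new
  where
  prev : ℕ → ℕ
  prev = conollyUpTo k
  n : ℕ
  n = suc k
  new : ℕ
  new = if n ≤ᵇ 2 then 1
        else prev (n ∸ prev (n ∸ 1)) + prev (n ∸ 1 ∸ prev (n ∸ 2))

C : ℕ → ℕ
C n = conollyUpTo n n

m1UpTo : ℕ → (ℕ → ℕ)
m1UpTo zero = λ _ → 0
m1UpTo (suc k) = λ i → if i ≤ᵇ k then prev i else new
  where
  prev : ℕ → ℕ
  prev = m1UpTo k
  n : ℕ
  n = suc k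
  new : ℕ
  new = if n ≤ᵇ 2 then 1 else suc (prev (n ∸ C (n ∸ 1)))

M₁ : ℕ → ℕ
M₁ n = m1UpTo n n

SlowGrowing : (ℕ → ℕ) → Set
SlowGrowing f = ∀ n → 1 ≤ n → (f (suc n) ≡ f n) ⊎ (f (suc n) ≡ suc (f n))

-- The Conolly sequence is self-similar at powers of two.  For h = 2^t we prove
-- the invariant `Level h`: C(2h) = h, C(4h) = 2h, C(2h + x) = h + C(x + 1) for
-- 0 < x < 2h, and every lag i − C(i) with 2 ≤ i ≤ 2h lies in [1, h].  The base
-- case h = 1 is a computation; the doubling step `double` re-derives the shift
-- identity on (4h, 8h) by induction along the recurrence, using that all lags
-- below 4h lie in [1, 2h), where the shift at level h applies.  The invariant
-- also gives that lags on [2h, 4h) lie in [h, 2h), so n ↦ n − C(n − 1) maps the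
-- block (2h, 4h] into (h, 2h]; by induction M₁ equals g on the block of
-- generation g (`M₁-block`).  Since n + 1 either stays in the block of n or
-- opens the next one, M₁ is slow-growing and its level sets are the blocks.
module Submission where

open import Defs
open import Data.Nat
open import Data.Nat.Properties
open import Data.Bool using (true; false; if_then_else_)
open import Data.Product using (Σ; _×_; _,_)
open import Data.Sum using (_⊎_; inj₁; inj₂)
open import Relation.Nullary using (yes; no)
open import Relation.Binary.PropositionalEquality
open import Algebra.Properties.CommutativeSemigroup +-commutativeSemigroup
  using (interchange)

if-≤ᵇ : ∀ {i k} {a b : ℕ} → i ≤ k → (if i ≤ᵇ k then a else b) ≡ a
if-≤ᵇ {i} {k} i≤k with i ≤ᵇ k | ≤⇒≤ᵇ i≤k
... | true | _ = refl

if-false : ∀ {b} {a c : ℕ} → b ≡ false → (if b then a else c) ≡ c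
if-false refl = refl

n<ᵇn : ∀ n → (n <ᵇ n) ≡ false
n<ᵇn zero    = refl
n<ᵇn (suc n) = n<ᵇn n

Stable : (ℕ → ℕ → ℕ) → Set
Stable T = ∀ k i → i ≤ k → T (suc k) i ≡ T k i

stable-diag : ∀ {T} → Stable T → ∀ {i k} → i ≤ k → T k i ≡ T i i
stable-diag {T} st i≤k = go (≤⇒≤′ i≤k)
  where
  go : ∀ {i k} → i ≤′ k → T k i ≡ T i i
  go ≤′-refl       = refl
  go (≤′-step i≤k) = trans (st _ _ (≤′⇒≤ i≤k)) (go i≤k)

conolly-diag : ∀ {i k} → i ≤ k → conollyUpTo k i ≡ C i
conolly-diag = stable-diag {conollyUpTo} (λ k i i≤k → if-≤ᵇ i≤k)

m1-diag : ∀ {i k} → i ≤ k → m1UpTo k i ≡ M₁ i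
m1-diag = stable-diag {m1UpTo} (λ k i i≤k → if-≤ᵇ i≤k)

∸-from : ∀ {p c n} → p + c ≡ n → n ∸ c ≡ p
∸-from {p} {c} refl = m+n∸n≡m p c

-- Stating it with additive equations keeps
-- truncated subtraction out of every later computation.
C-rec : ∀ {n p q} → 2 ≤ n → 1 ≤ C n → p + C n ≡ suc n → q + C (n ∸ 1) ≡ n →
        C (suc n) ≡ C p + C q
C-rec {suc (suc j)} {p} {q} (s≤s (s≤s _)) C-pos p+C≡ q+C≡ = begin
    C (suc n)
  ≡⟨ if-false (n<ᵇn j) ⟩
    T (suc n ∸ C n) + T (n ∸ T (suc j))
  ≡⟨ cong (λ c → T (suc n ∸ C n) + T (n ∸ c)) (conolly-diag (n≤1+n (suc j))) ⟩
    T (suc n ∸ C n) + T (n ∸ C (suc j))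
  ≡⟨ cong₂ (λ a b → T a + T b) (∸-from {p} {C n} p+C≡) (∸-from {q} {C (suc j)} q+C≡) ⟩
    T p + T q
  ≡⟨ cong₂ _+_ (conolly-diag p≤n) (conolly-diag q≤n) ⟩
    C p + C q
  ∎
  where
  open ≡-Reasoning
  n = suc (suc j)
  T = conollyUpTo n
  p≤n : p ≤ n
  p≤n = ≤-pred (subst (p <_) p+C≡ (m<m+n p C-pos))
  q≤n : q ≤ n
  q≤n = subst (q ≤_) q+C≡ (m≤m+n q _)

M₁-rec : ∀ {n p} → 2 ≤ n → 1 ≤ C n → p + C n ≡ suc n → M₁ (suc n) ≡ suc (M₁ p)
M₁-rec {suc (suc j)} {p} (s≤s (s≤s _)) C-pos p+C≡ = trans (if-false (n<ᵇn j))
  (cong suc (trans (cong (m1UpTo (suc (suc j))) (∸-from {p} {C (suc (suc j))} p+C≡)) (m1-diag p≤n)))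
  where
  p≤n : p ≤ suc (suc j)
  p≤n = ≤-pred (subst (p <_) p+C≡ (m<m+n p C-pos))

-- Lags.  The lag of i is i − C(i); `LagIn i lo hi` records that it lies in
-- [lo, hi) together with the positivity of C(i) that the recurrences need.
record LagIn (i lo hi : ℕ) : Set where
  constructor lagIn
  field
    lag     : ℕ
    lag+C≡i : lag + C i ≡ i
    lo≤lag  : lo ≤ lag
    lag<hi  : lag < hi
    C-pos   : 1 ≤ C i

widen : ∀ {i lo lo′ hi hi′} → lo′ ≤ lo → hi ≤ hi′ → LagIn i lo hi → LagIn i lo′ hi′
widen lo′≤lo hi≤hi′ (lagIn d e lo≤d d<hi pos) =
  lagIn d e (≤-trans lo′≤lo lo≤d) (≤-trans d<hi hi≤hi′) pos

record Level (h : ℕ) : Set where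
  field
    C-2h      : C (h + h) ≡ h
    C-4h      : C ((h + h) + (h + h)) ≡ h + h
    shift     : ∀ x → 1 ≤ x → x < h + h → C ((h + h) + x) ≡ h + C (suc x)
    lagUpTo2h : ∀ i → 2 ≤ i → i ≤ h + h → LagIn i 1 (suc h)

level-1 : Level 1
level-1 = record { C-2h = refl ; C-4h = refl ; shift = shift ; lagUpTo2h = lags }
  where
  shift : ∀ x → 1 ≤ x → x < 2 → C (2 + x) ≡ 1 + C (suc x)
  shift 1 _ _ = refl
  shift (suc (suc _)) _ (s≤s (s≤s ()))
  lags : ∀ i → 2 ≤ i → i ≤ 2 → LagIn i 1 2
  lags 2 _ _ = lagIn 1 refl ≤-refl ≤-refl ≤-refl
  lags 1 (s≤s ()) _
  lags (suc (suc (suc _))) _ (s≤s (s≤s ()))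

module LagsAtLevel {h : ℕ} (L : Level h) (1≤h : 1 ≤ h) where
  open Level L

  private
    H = h + h
    Q = H + H

  -- On [2h, 4h) the lag lies in [h, 2h): for m = 2h + x the shift gives
  -- lag(m) = h + lag(x + 1) − 1, and lag(x + 1) ∈ [1, h].
  lagFrom2h : ∀ m → H ≤ m → m < Q → LagIn m h H
  lagFrom2h m H≤m m<Q with m ∸ H | m+[n∸m]≡n H≤m
  ... | zero | refl rewrite +-identityʳ H =
    lagIn h (cong (h +_) C-2h) ≤-refl (m<m+n h 1≤h) (subst (1 ≤_) (sym C-2h) 1≤h)
  ... | suc x | refl with lagUpTo2h (suc (suc x)) (s≤s (s≤s z≤n)) (+-cancelˡ-< H (suc x) H m<Q)
  ...   | lagIn (suc e) e+C≡ _ (s≤s e<h) pos = lagIn (h + e) lag+C≡ (m≤m+n h e) (+-monoʳ-< h e<h)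
                                                (subst (1 ≤_) (sym C-m) (≤-trans pos (m≤n+m _ h)))
    where
    C-m : C (H + suc x) ≡ h + C (suc (suc x))
    C-m = shift (suc x) (s≤s z≤n) (+-cancelˡ-< H (suc x) H m<Q)
    lag+C≡ : (h + e) + C (H + suc x) ≡ H + suc x
    lag+C≡ = begin
        (h + e) + C (H + suc x)
      ≡⟨ cong ((h + e) +_) C-m ⟩
        (h + e) + (h + C (suc (suc x)))
      ≡⟨ interchange h e h _ ⟩
        H + (e + C (suc (suc x)))
      ≡⟨ cong (H +_) (suc-injective e+C≡) ⟩
        H + suc x
      ∎
      where open ≡-Reasoning

  lagBelow4h : ∀ i → 2 ≤ i → i < Q → LagIn i 1 H
  lagBelow4h i 2≤i i<Q with i ≤? H
  ... | yes i≤H = widen ≤-refl (+-monoˡ-≤ h 1≤h) (lagUpTo2h i 2≤i i≤H)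
  ... | no  i≰H = widen 1≤h ≤-refl (lagFrom2h i (<⇒≤ (≰⇒> i≰H)) i<Q)

-- Writing h = h₀ + 1 makes 2h = H⁻ + 1 and 4h = Q⁻ + 1 definitionally, so the
-- predecessors H⁻ = 2h − 1 and Q⁻ = 4h − 1 need no subtraction.
module Doubling (h₀ : ℕ) (L : Level (suc h₀)) where
  open Level L
  open LagsAtLevel L (s≤s z≤n)
  open ≡-Reasoning

  h H Q H⁻ Q⁻ : ℕ
  h  = suc h₀
  H  = h + h
  Q  = H + H
  H⁻ = h₀ + h
  Q⁻ = H⁻ + H

  1≤H⁻ : 1 ≤ H⁻
  1≤H⁻ = ≤-trans (s≤s z≤n) (m≤n+m h h₀)

  1≤H : 1 ≤ H
  1≤H = s≤s z≤n

  1≤Q⁻ : 1 ≤ Q⁻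
  1≤Q⁻ = ≤-trans 1≤H⁻ (m≤m+n H⁻ H)

  C-Q⁻ : C Q⁻ ≡ H
  C-Q⁻ = begin
      C (H⁻ + H)   ≡⟨ cong C (+-comm H⁻ H) ⟩
      C (H + H⁻)   ≡⟨ shift H⁻ 1≤H⁻ ≤-refl ⟩
      h + C H      ≡⟨ cong (h +_) C-2h ⟩
      H            ∎

  C-H+1 : C (suc H) ≡ suc h
  C-H+1 = trans (cong C (+-comm 1 H)) (trans (shift 1 ≤-refl (s≤s 1≤H⁻)) (+-comm h 1))

  C-Q+1 : C (suc Q) ≡ suc H
  C-Q+1 = begin
      C (suc Q)
    ≡⟨ C-rec {Q} {suc H} {H} (s≤s 1≤Q⁻) (subst (1 ≤_) (sym C-4h) 1≤H)
             (cong (suc H +_) C-4h) (cong (H +_) C-Q⁻) ⟩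
      C (suc H) + C H
    ≡⟨ cong₂ _+_ C-H+1 C-2h ⟩
      suc H
    ∎

  C-Q+2 : C (suc (suc Q)) ≡ suc (suc H)
  C-Q+2 = begin
      C (suc (suc Q))
    ≡⟨ C-rec {suc Q} {suc H} {suc H} (s≤s (s≤s z≤n)) (subst (1 ≤_) (sym C-Q+1) (s≤s z≤n))
             (trans (cong (suc H +_) C-Q+1) (cong suc (+-suc H H))) (cong (suc H +_) C-4h) ⟩
      C (suc H) + C (suc H)
    ≡⟨ cong₂ _+_ C-H+1 C-H+1 ⟩
      suc h + suc h
    ≡⟨ cong suc (+-suc h h) ⟩
      suc (suc H)
    ∎

  -- The lags of
  -- y + 1 and y + 2 are in [1, 2h), where the shift at level h applies.
  shift-step : ∀ y → 1 ≤ y → suc (suc y) < Q →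
               C (Q + y) ≡ H + C (suc y) →
               C (Q + suc y) ≡ H + C (suc (suc y)) →
               C (Q + suc (suc y)) ≡ H + C (suc (suc (suc y)))
  shift-step y 1≤y y+2<Q C-Q+y C-Q+y+1
    with lagBelow4h (suc (suc y)) (s≤s (s≤s z≤n)) y+2<Q
       | lagBelow4h (suc y) (s≤s 1≤y) (<-trans (n<1+n (suc y)) y+2<Q)
  ... | lagIn d₁ d₁+C≡ 1≤d₁ d₁<H pos₁ | lagIn d₂ d₂+C≡ 1≤d₂ d₂<H _ = begin
      C (Q + suc (suc y))
    ≡⟨ cong C Q+y+2≡ ⟩
      C (suc n)
    ≡⟨ C-rec {n} {H + d₁} {H + d₂} (s≤s (s≤s z≤n))
             (subst (1 ≤_) (sym C-n) (≤-trans 1≤H (m≤m+n H _)))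
             (recombine n (suc (suc y)) C-n d₁+C≡ Q+y+2≡)
             (recombine (Q + y) (suc y) C-Q+y d₂+C≡ (+-suc Q y)) ⟩
      C (H + d₁) + C (H + d₂)
    ≡⟨ cong₂ _+_ (shift d₁ 1≤d₁ d₁<H) (shift d₂ 1≤d₂ d₂<H) ⟩
      (h + C (suc d₁)) + (h + C (suc d₂))
    ≡⟨ interchange h _ h _ ⟩
      H + (C (suc d₁) + C (suc d₂))
    ≡⟨ cong (H +_) (sym (C-rec (s≤s (s≤s z≤n)) pos₁ (cong suc d₁+C≡) (cong suc d₂+C≡))) ⟩
      H + C (suc (suc (suc y)))
    ∎
    where
    n = suc (Q + y)
    Q+y+2≡ : Q + suc (suc y) ≡ suc n
    Q+y+2≡ = trans (+-suc Q (suc y)) (cong suc (+-suc Q y))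
    C-n : C n ≡ H + C (suc (suc y))
    C-n = trans (cong C (sym (+-suc Q y))) C-Q+y+1
    recombine : ∀ k j {d k′} → C k ≡ H + C j → d + C j ≡ j → Q + j ≡ k′ →
                (H + d) + C k ≡ k′
    recombine k j {d} C-k d+C≡ Q+j≡ = begin
        (H + d) + C k    ≡⟨ cong ((H + d) +_) C-k ⟩
        (H + d) + (H + C j) ≡⟨ interchange H d H (C j) ⟩
        Q + (d + C j)    ≡⟨ cong (Q +_) d+C≡ ⟩
        Q + j            ≡⟨ Q+j≡ ⟩
        _                ∎

  shift′ : ∀ x → 1 ≤ x → x < Q → C (Q + x) ≡ H + C (suc x)
  shift′ 1 _ _ = trans (cong C (+-comm Q 1)) (trans C-Q+1 (+-comm 1 H))
  shift′ 2 _ _ = trans (cong C (+-comm Q 2)) (trans C-Q+2 (+-comm 2 H))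
  shift′ (suc (suc (suc y))) _ y+3<Q =
    shift-step (suc y) (s≤s z≤n) y+3<Q
      (shift′ (suc y) (s≤s z≤n) (<-trans (n<1+n _) (<-trans (n<1+n _) y+3<Q)))
      (shift′ (suc (suc y)) (s≤s z≤n) (<-trans (n<1+n _) y+3<Q))

  -- C(8h) = 4h, from the recurrence at 8h using C(8h − 1) = C(8h − 2) = 4h.
  C-8h : C (Q + Q) ≡ Q
  C-8h = begin
      C (Q + Q)
    ≡⟨ cong C (sym 8h≡) ⟩
      C (suc (suc m))
    ≡⟨ C-rec {suc m} {Q} {Q⁻} (s≤s (≤-trans (s≤s z≤n) (m≤m+n Q (H⁻ + H⁻))))
             (subst (1 ≤_) (sym C-m+1) (s≤s z≤n))
             (trans (cong (Q +_) C-m+1) (sym 8h≡))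
             (trans (cong (Q⁻ +_) C-m) (trans (+-comm Q⁻ Q) (sym 8h−1≡))) ⟩
      C Q + C Q⁻
    ≡⟨ cong₂ _+_ C-4h C-Q⁻ ⟩
      Q
    ∎
    where
    m = Q + (H⁻ + H⁻)
    8h−1≡ : suc m ≡ Q + Q⁻
    8h−1≡ = sym (trans (cong (Q +_) (+-suc H⁻ H⁻)) (+-suc Q (H⁻ + H⁻)))
    8h≡ : suc (suc m) ≡ Q + Q
    8h≡ = trans (cong suc 8h−1≡) (sym (+-suc Q Q⁻))
    C-m+1 : C (suc m) ≡ Q
    C-m+1 = trans (cong C 8h−1≡) (trans (shift′ Q⁻ 1≤Q⁻ ≤-refl) (cong (H +_) C-4h))
    C-m : C m ≡ Q
    C-m = trans (shift′ (H⁻ + H⁻) (≤-trans 1≤H⁻ (m≤m+n H⁻ H⁻)) (s≤s (+-monoʳ-≤ H⁻ (n≤1+n H⁻))))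
                (cong (H +_) (trans (cong C (sym (+-suc H⁻ H⁻))) C-Q⁻))

  lagUpTo4h : ∀ i → 2 ≤ i → i ≤ Q → LagIn i 1 (suc H)
  lagUpTo4h i 2≤i i≤Q with m≤n⇒m<n∨m≡n i≤Q
  ... | inj₁ i<Q  = widen ≤-refl (n≤1+n H) (lagBelow4h i 2≤i i<Q)
  ... | inj₂ refl = lagIn H (cong (H +_) C-4h) 1≤H ≤-refl (subst (1 ≤_) (sym C-4h) 1≤H)

  doubled : Level H
  doubled = record { C-2h = C-4h ; C-4h = C-8h ; shift = shift′ ; lagUpTo2h = lagUpTo4h }

double : ∀ {h} → 1 ≤ h → Level h → Level (h + h)
double {suc h₀} _ L = Doubling.doubled h₀ L

2^-double : ∀ t → 2 ^ suc t ≡ 2 ^ t + 2 ^ t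
2^-double t = cong (2 ^ t +_) (+-identityʳ (2 ^ t))

level : ∀ t → Level (2 ^ t)
level zero    = level-1
level (suc t) = subst Level (sym (2^-double t)) (double (m^n>0 2 t) (level t))

InBlock : ℕ → ℕ → Set
InBlock g n = (2 ^ (g ∸ 1) + 1 ≤ n) × (n ≤ 2 ^ g)

-- M₁ equals g on the block of generation g ≥ 2.  For n in the block (2h, 4h],
-- h = 2^(t+1), the lag d of k = n − 1 satisfies h ≤ d < 2h, so
-- n − C(n − 1) = d + 1 lies in the previous block (h, 2h].
M₁-block : ∀ t {n} → InBlock (suc (suc t)) n → M₁ n ≡ suc (suc t)
M₁-block zero {3} _ = refl
M₁-block zero {4} _ = refl
M₁-block zero {suc (suc (suc (suc (suc _))))} (_ , s≤s (s≤s (s≤s (s≤s ()))))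
M₁-block zero {0} (() , _)
M₁-block zero {1} (s≤s () , _)
M₁-block zero {2} (s≤s (s≤s ()) , _)
M₁-block (suc t) {zero} (lo , _) with subst (_≤ 0) (+-comm (2 ^ suc (suc t)) 1) lo
... | ()
M₁-block (suc t) {suc k} (lo , hi) =
  from-lag (LagsAtLevel.lagFrom2h (level (suc t)) 1≤h k 2h≤k k<4h)
  where
  h = 2 ^ suc t
  1≤h : 1 ≤ h
  1≤h = m^n>0 2 (suc t)
  2h≤k : h + h ≤ k
  2h≤k = subst (_≤ k) (2^-double (suc t)) (≤-pred (subst (_≤ suc k) (+-comm (2 ^ suc (suc t)) 1) lo))
  k<4h : k < (h + h) + (h + h)
  k<4h = subst (suc k ≤_) 4h≡ hi
    where
    4h≡ : 2 ^ suc (suc (suc t)) ≡ (h + h) + (h + h)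
    4h≡ = trans (2^-double (suc (suc t))) (cong₂ _+_ (2^-double (suc t)) (2^-double (suc t)))
  from-lag : LagIn k h (h + h) → M₁ (suc k) ≡ suc (suc (suc t))
  from-lag (lagIn d d+C≡ h≤d d<2h pos) =
    trans (M₁-rec (≤-trans (+-mono-≤ 1≤h 1≤h) 2h≤k) pos (cong suc d+C≡))
          (cong suc (M₁-block t (subst (_≤ suc d) (+-comm 1 h) (s≤s h≤d) ,
                                 subst (suc d ≤_) (sym (2^-double (suc t))) d<2h)))

next-block : ∀ g n → InBlock g n → InBlock g (suc n) ⊎ (n ≡ 2 ^ g × InBlock (suc g) (suc n))
next-block g n (lo , hi) with m≤n⇒m<n∨m≡n hi
... | inj₁ n<2^g = inj₁ (m≤n⇒m≤1+n lo , n<2^g)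
... | inj₂ refl  = inj₂ (refl , ≤-reflexive (+-comm (2 ^ g) 1) ,
                         ≤-trans (+-monoˡ-≤ (2 ^ g) (m^n>0 2 g)) (≤-reflexive (sym (2^-double g))))

blockOf : ∀ j → Σ ℕ λ t → InBlock (suc (suc t)) (3 + j)
blockOf zero = zero , ≤-refl , n≤1+n 3
blockOf (suc j) with blockOf j
... | t , b with next-block (suc (suc t)) (3 + j) b
...   | inj₁ b′       = t , b′
...   | inj₂ (_ , b′) = suc t , b′

M₁-slowGrowing : SlowGrowing M₁
M₁-slowGrowing 1 _ = inj₁ refl
M₁-slowGrowing 2 _ = inj₂ refl
M₁-slowGrowing (suc (suc (suc j))) _ with blockOf j
... | t , b with next-block (suc (suc t)) (3 + j) b
...   | inj₁ b′       = inj₁ (trans (M₁-block t b′) (sym (M₁-block t b)))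
...   | inj₂ (_ , b′) = inj₂ (trans (M₁-block (suc t) b′) (cong suc (sym (M₁-block t b))))

M₁-level⇒block : ∀ t n → 1 ≤ n → M₁ n ≡ suc (suc t) → InBlock (suc (suc t)) n
M₁-level⇒block t 1 _ ()
M₁-level⇒block t 2 _ ()
M₁-level⇒block t (suc (suc (suc j))) _ M₁n≡ with blockOf j
... | t′ , b with suc-injective (suc-injective (trans (sym (M₁-block t′ b)) M₁n≡))
...   | refl = b

mainTheorem6 : SlowGrowing M₁
    × (∀ (g : ℕ) → 2 ≤ g → ∀ (n : ℕ) → 1 ≤ n →
    (M₁ n ≡ g → (2 ^ (g ∸ 1) + 1 ≤ n) × (n ≤ 2 ^ g))
    × ((2 ^ (g ∸ 1) + 1 ≤ n) × (n ≤ 2 ^ g) → M₁ n ≡ g))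
mainTheorem6 = M₁-slowGrowing , levelSets
  where
  levelSets : ∀ g → 2 ≤ g → ∀ n → 1 ≤ n → (M₁ n ≡ g → InBlock g n) × (InBlock g n → M₁ n ≡ g)
  levelSets 1 (s≤s ()) _ _
  levelSets (suc (suc t)) _ n 1≤n = M₁-level⇒block t n 1≤n , M₁-block t
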